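{- There is an absolute constant $C > 0$ such that the following holds. Consider the negative-fill variable-processor cup game on $n$ cups against the greedy emptier. Let $k, m$ be positive integers with $4k \mid m$ and $m \le n$, and suppose that at the current moment at least $m$ cups have fill exactly $0$. Then the filler can ensure that, within at most $C k^3$ further rounds, at least $m/4$ cups have fill exactly $k/2$.
   Context: Negative-fill variable-processor cup game: $n$ cups with real (possibly negative) fills. Each round the filler chooses an integer $1 \le p \le n$ and $a_1,\dots,a_n\in[0,1]$ with $\sum a_i = p$ and adds $a_i$ to cup $i$; the emptier then chooses exactly $p$ distinct cups and subtracts $1$ from each of their fills. The greedy emptier chooses the $p$ cups with the largest fills after the filler's move.
   Formalization: The cup fills are rational rather than real, and the filler's amounts $a_1,\dots,a_n$ are taken in the rationals. -}

module Defs where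

open import Data.Nat as ℕ using (ℕ; zero; suc)
open import Data.Integer using (+_)
open import Data.Rational using (ℚ; 0ℚ; 1ℚ; _+_; _-_; _≤_; _/_)
open import Data.Rational.Properties using (_≟_)
open import Data.Fin using (Fin; zero; suc)
open import Data.Fin.Subset using (Subset; _∈_; _∉_; ∣_∣)
open import Data.Vec using (lookup)
open import Data.Bool using (true; false)
open import Data.Sum using (_⊎_)
open import Data.Product using (Σ; _×_; ∃-syntax)
open import Relation.Nullary using (yes; no)
open import Relation.Binary.PropositionalEquality using (_≡_)

Fills : ℕ → Set
Fills n = Fin n → ℚ

sumℚ : ∀ {n} → (Fin n → ℚ) → ℚ
sumℚ {zero}  f = 0ℚ
sumℚ {suc n} f = f zero + sumℚ (λ i → f (suc i))

countEq : ∀ {n} → Fills n → ℚ → ℕ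
countEq {zero}  f q = 0
countEq {suc n} f q with f zero ≟ q
... | yes _ = suc (countEq (λ i → f (suc i)) q)
... | no  _ = countEq (λ i → f (suc i)) q

ℕ→ℚ : ℕ → ℚ
ℕ→ℚ p = + p / 1

ValidFill : ∀ {n} → ℕ → (Fin n → ℚ) → Set
ValidFill {n} p a =
  (1 ℕ.≤ p) × (p ℕ.≤ n) × (∀ i → (0ℚ ≤ a i) × (a i ≤ 1ℚ)) × (sumℚ a ≡ ℕ→ℚ p)

addFill : ∀ {n} → Fills n → (Fin n → ℚ) → Fills n
addFill f a i = f i + a i

GreedyChoice : ∀ {n} → Fills n → ℕ → Subset n → Set
GreedyChoice g p S = (∣ S ∣ ≡ p) × (∀ i j → i ∈ S → j ∉ S → g j ≤ g i)

empty : ∀ {n} → Fills n → Subset n → Fills n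
empty g S i with lookup S i
... | true  = g i - 1ℚ
... | false = g i

-- CanForce t Goal f : from configuration f, the filler can guarantee that
-- Goal holds within at most t further rounds against the greedy emptier
-- (whatever way it breaks ties).
CanForce : ∀ {n} → ℕ → (Fills n → Set) → Fills n → Set
CanForce zero    Goal f = Goal f
CanForce (suc t) Goal f =
  Goal f ⊎ (Σ ℕ λ p → Σ (Fin _ → ℚ) λ a → ValidFill p a ×
     (∀ S → GreedyChoice (addFill f a) p S →
        CanForce t Goal (empty (addFill f a) S)))

-- The filler keeps 4k tokens on the levels w = 0, 1, …, 4k+1: a token at level w
-- stands for u = m/(4k) cups of fill k/2 − w/2, and initially all tokens sit at
-- level k, i.e. at fill 0. While some level 1 ≤ w ≤ 4k carries two tokens, the
-- filler splits them: it pours 1 into every cup fuller than x = k/2 − w/2 and ½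
-- into 2u cups of fill x. The greedy emptier is then forced to empty exactly the
-- fuller cups and u of the 2u, so u cups end at x + ½ and u at x − ½: one token
-- moves up a level and one down. A split preserves the number of tokens and their
-- total level 4k·k, and raises the energy Σ w² c_w by 2. The energy never exceeds
-- 4k(4k+1)², so after O(k³) rounds the levels 1, …, 4k carry at most one token
-- each. If fewer than k tokens were then at level 0, more than 3k tokens would sit
-- on almost distinct levels ≥ 1, and their total level would exceed 4k·k. Hence
-- level 0, of fill k/2, holds k tokens, that is ku = m/4 cups.
module Submission where

open import Defs

module Subsets where

  open import Data.Nat using (ℕ; zero; suc; _+_; _≤_; s≤s)
  open import Data.Nat.Properties using (+-suc; +-identityʳ; m≤m+n)
  open import Data.Fin using (Fin; zero; suc)
  open import Data.Fin.Subset
  open import Data.Fin.Subset.Properties using (Empty-unique; ∣⊥∣≡0; ⊆-min; s⊆s)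
  open import Data.Vec using ([]; _∷_; here; there)
  open import Data.Product using (∃; _×_; _,_)
  open import Data.Empty using (⊥-elim)
  open import Function using (_∘_)
  open import Relation.Nullary using (yes; no; does)
  open import Relation.Unary using (Pred; Decidable)
  open import Relation.Binary.PropositionalEquality

  private variable
    m : ℕ

  subset : ∀ {ℓ} {P : Pred (Fin m) ℓ} → Decidable P → Subset m
  subset {zero}  P? = []
  subset {suc m} P? = does (P? zero) ∷ subset (P? ∘ suc)

  ∈-subset⁺ : ∀ {ℓ} {P : Pred (Fin m) ℓ} (P? : Decidable P) {i} → P i → i ∈ subset P?
  ∈-subset⁺ P? {zero} Pi with P? zero
  ... | yes _  = here
  ... | no ¬Pi = ⊥-elim (¬Pi Pi)
  ∈-subset⁺ P? {suc i} Pi = there (∈-subset⁺ (P? ∘ suc) Pi)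

  ∈-subset⁻ : ∀ {ℓ} {P : Pred (Fin m) ℓ} (P? : Decidable P) {i} → i ∈ subset P? → P i
  ∈-subset⁻ P? {zero} i∈ with P? zero | i∈
  ... | yes Pi | _  = Pi
  ... | no  _  | ()
  ∈-subset⁻ P? {suc i} (there i∈) = ∈-subset⁻ (P? ∘ suc) i∈

  ∣p∪q∣+∣p∩q∣≡∣p∣+∣q∣ : ∀ (p q : Subset m) → ∣ p ∪ q ∣ + ∣ p ∩ q ∣ ≡ ∣ p ∣ + ∣ q ∣
  ∣p∪q∣+∣p∩q∣≡∣p∣+∣q∣ []            []            = refl
  ∣p∪q∣+∣p∩q∣≡∣p∣+∣q∣ (inside  ∷ p) (inside  ∷ q) = begin
    suc ∣ p ∪ q ∣ + suc ∣ p ∩ q ∣      ≡⟨ +-suc (suc ∣ p ∪ q ∣) ∣ p ∩ q ∣ ⟩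
    suc (suc (∣ p ∪ q ∣ + ∣ p ∩ q ∣))  ≡⟨ cong (λ s → suc (suc s)) (∣p∪q∣+∣p∩q∣≡∣p∣+∣q∣ p q) ⟩
    suc (suc (∣ p ∣ + ∣ q ∣))          ≡⟨ cong suc (+-suc ∣ p ∣ ∣ q ∣) ⟨
    suc ∣ p ∣ + suc ∣ q ∣              ∎
    where open ≡-Reasoning
  ∣p∪q∣+∣p∩q∣≡∣p∣+∣q∣ (inside  ∷ p) (outside ∷ q) = cong suc (∣p∪q∣+∣p∩q∣≡∣p∣+∣q∣ p q)
  ∣p∪q∣+∣p∩q∣≡∣p∣+∣q∣ (outside ∷ p) (inside  ∷ q) =
    trans (cong suc (∣p∪q∣+∣p∩q∣≡∣p∣+∣q∣ p q)) (sym (+-suc ∣ p ∣ ∣ q ∣))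
  ∣p∪q∣+∣p∩q∣≡∣p∣+∣q∣ (outside ∷ p) (outside ∷ q) = ∣p∪q∣+∣p∩q∣≡∣p∣+∣q∣ p q

  ∣p∪q∣≤∣p∣+∣q∣ : ∀ (p q : Subset m) → ∣ p ∪ q ∣ ≤ ∣ p ∣ + ∣ q ∣
  ∣p∪q∣≤∣p∣+∣q∣ p q = subst (∣ p ∪ q ∣ ≤_) (∣p∪q∣+∣p∩q∣≡∣p∣+∣q∣ p q) (m≤m+n _ _)

  ∣p∪q∣≡∣p∣+∣q∣ : ∀ (p q : Subset m) → Empty (p ∩ q) → ∣ p ∪ q ∣ ≡ ∣ p ∣ + ∣ q ∣
  ∣p∪q∣≡∣p∣+∣q∣ {m} p q p∩q-empty = begin
    ∣ p ∪ q ∣              ≡⟨ +-identityʳ _ ⟨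
    ∣ p ∪ q ∣ + 0          ≡⟨ cong (∣ p ∪ q ∣ +_) (∣⊥∣≡0 m) ⟨
    ∣ p ∪ q ∣ + ∣ ⊥ {m} ∣  ≡⟨ cong (λ r → ∣ p ∪ q ∣ + ∣ r ∣) (Empty-unique p∩q-empty) ⟨
    ∣ p ∪ q ∣ + ∣ p ∩ q ∣  ≡⟨ ∣p∪q∣+∣p∩q∣≡∣p∣+∣q∣ p q ⟩
    ∣ p ∣ + ∣ q ∣          ∎
    where open ≡-Reasoning

  ∣p∩q∣+∣p∩∁q∣≡∣p∣ : ∀ (p q : Subset m) → ∣ p ∩ q ∣ + ∣ p ∩ ∁ q ∣ ≡ ∣ p ∣
  ∣p∩q∣+∣p∩∁q∣≡∣p∣ []            []            = refl
  ∣p∩q∣+∣p∩∁q∣≡∣p∣ (inside  ∷ p) (inside  ∷ q) = cong suc (∣p∩q∣+∣p∩∁q∣≡∣p∣ p q)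
  ∣p∩q∣+∣p∩∁q∣≡∣p∣ (inside  ∷ p) (outside ∷ q) = trans (+-suc _ _) (cong suc (∣p∩q∣+∣p∩∁q∣≡∣p∣ p q))
  ∣p∩q∣+∣p∩∁q∣≡∣p∣ (outside ∷ p) (inside  ∷ q) = ∣p∩q∣+∣p∩∁q∣≡∣p∣ p q
  ∣p∩q∣+∣p∩∁q∣≡∣p∣ (outside ∷ p) (outside ∷ q) = ∣p∩q∣+∣p∩∁q∣≡∣p∣ p q

  subset-of-size : ∀ {b} (p : Subset m) → b ≤ ∣ p ∣ → ∃ λ q → q ⊆ p × ∣ q ∣ ≡ b
  subset-of-size {m} {zero}  p             _       = ⊥ , ⊆-min p , ∣⊥∣≡0 m
  subset-of-size {m} {suc b} (inside  ∷ p) (s≤s b≤) with subset-of-size p b≤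
  ... | q , q⊆p , ∣q∣≡b = inside ∷ q , s⊆s q⊆p , cong suc ∣q∣≡b
  subset-of-size {m} {suc b} (outside ∷ p) b<      with subset-of-size p b<
  ... | q , q⊆p , ∣q∣≡b = outside ∷ q , s⊆s q⊆p , ∣q∣≡b

module Rationals where

  open import Data.Nat as ℕ using (suc)
  open import Data.Integer as ℤ using (+_)
  open import Data.Integer.Tactic.RingSolver using (solve-∀)
  open import Data.Rational as ℚ using (1ℚ; ½; _+_; _-_; _*_; _<_; _≤_; _/_)
  open import Data.Rational.Properties as ℚ using ()
  open import Data.Rational.Solver using (module +-*-Solver)
  import Data.Rational.Unnormalised as ℚᵘ
  import Data.Rational.Unnormalised.Properties as ℚᵘ
  open import Relation.Nullary using (¬_)
  open import Relation.Nullary.Decidable using (toWitness)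
  open import Relation.Binary.PropositionalEquality
  open +-*-Solver

  +-/-distrib : ∀ a b d .{{_ : ℕ.NonZero d}} → + (a ℕ.+ b) / d ≡ + a / d + + b / d
  +-/-distrib a b (suc e) = begin
    ℚ.fromℚᵘ (ℚᵘ.mkℚᵘ (+ (a ℕ.+ b)) e)             ≡⟨ ℚ.fromℚᵘ-cong sum≃ ⟩
    ℚ.fromℚᵘ (ℚ.toℚᵘ (+ a / suc e + + b / suc e))  ≡⟨ ℚ.fromℚᵘ-toℚᵘ _ ⟩
    + a / suc e + + b / suc e                      ∎
    where
    open ≡-Reasoning
    cross : ∀ x y z → (x ℤ.* z ℤ.+ y ℤ.* z) ℤ.* z ≡ (x ℤ.+ y) ℤ.* (z ℤ.* z)
    cross = solve-∀
    sum≃ : ℚᵘ.mkℚᵘ (+ (a ℕ.+ b)) e ℚᵘ.≃ ℚ.toℚᵘ (+ a / suc e + + b / suc e)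
    sum≃ = ℚᵘ.≃-sym (ℚᵘ.≃-trans (ℚ.toℚᵘ-homo-+ (+ a / suc e) (+ b / suc e))
             (ℚᵘ.≃-trans (ℚᵘ.+-cong (ℚ.toℚᵘ-fromℚᵘ (ℚᵘ.mkℚᵘ (+ a) e)) (ℚ.toℚᵘ-fromℚᵘ (ℚᵘ.mkℚᵘ (+ b) e)))
               (ℚᵘ.*≡* (cross (+ a) (+ b) (+ suc e)))))

  ℕ→ℚ-+ : ∀ a b → ℕ→ℚ (a ℕ.+ b) ≡ ℕ→ℚ a + ℕ→ℚ b
  ℕ→ℚ-+ a b = +-/-distrib a b 1

  p<p+½ : ∀ p → p < p + ½
  p<p+½ p = subst (_< p + ½) (ℚ.+-identityʳ p) (ℚ.+-monoʳ-< p (ℚ.positive⁻¹ ½))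

  p+½<p+1 : ∀ p → p + ½ < p + 1ℚ
  p+½<p+1 p = ℚ.+-monoʳ-< p (toWitness {a? = ½ ℚ.<? 1ℚ} _)

  p-½+½≡p : ∀ p → p - ½ + ½ ≡ p
  p-½+½≡p = solve 1 (λ p → p :- con ½ :+ con ½ := p) refl

  p+1-1≡p : ∀ p → p + 1ℚ - 1ℚ ≡ p
  p+1-1≡p = solve 1 (λ p → p :+ con 1ℚ :- con 1ℚ := p) refl

  p+½-1≡p-½ : ∀ p → p + ½ - 1ℚ ≡ p - ½
  p+½-1≡p-½ = solve 1 (λ p → p :+ con ½ :- con 1ℚ := p :- con ½) refl

  ½*[p+p]≡p : ∀ p → ½ * (p + p) ≡ p
  ½*[p+p]≡p = solve 1 (λ p → con ½ :* (p :+ p) := p) refl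

  p-½<p : ∀ p → p - ½ < p
  p-½<p p = subst (p - ½ <_) (p-½+½≡p p) (p<p+½ (p - ½))

  <⇒≱ : ∀ {p q} → p < q → ¬ (q ≤ p)
  <⇒≱ p<q q≤p = ℚ.<-irrefl refl (ℚ.<-≤-trans p<q q≤p)

module Cups where

  open Subsets
  open import Algebra.Bundles using (Ring)
  import Algebra.Properties.Semiring.Sum as SemiringSum
  open import Data.Nat using (ℕ; zero; suc)
  open import Data.Fin using (Fin; zero; suc)
  open import Data.Fin.Subset using (Subset; inside; outside; _∈_; _∉_; ∣_∣)
  open import Data.Vec using ([]; _∷_; lookup)
  open import Data.Vec.Properties using ([]=⇒lookup; lookup⇒[]=)
  open import Data.Bool using (true; false; if_then_else_)
  open import Data.Rational using (ℚ; 0ℚ; 1ℚ; _+_; _-_; _*_)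
  open import Data.Rational.Properties using (_≟_; +-identityˡ; +-*-ring)
  open import Data.Empty using (⊥-elim)
  open import Function using (_∘_)
  open import Relation.Nullary using (yes; no)
  open import Relation.Binary.PropositionalEquality

  private variable
    m : ℕ

  cupsAt : Fills m → ℚ → Subset m
  cupsAt f y = subset (λ i → f i ≟ y)

  countEq≡∣cupsAt∣ : ∀ (f : Fills m) y → countEq f y ≡ ∣ cupsAt f y ∣
  countEq≡∣cupsAt∣ {zero}  f y = refl
  countEq≡∣cupsAt∣ {suc m} f y with f zero ≟ y
  ... | yes _ = cong suc (countEq≡∣cupsAt∣ (f ∘ suc) y)
  ... | no  _ = countEq≡∣cupsAt∣ (f ∘ suc) y

  ∈-cupsAt⁺ : ∀ {f : Fills m} {y i} → f i ≡ y → i ∈ cupsAt f y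
  ∈-cupsAt⁺ = ∈-subset⁺ _

  ∈-cupsAt⁻ : ∀ {f : Fills m} {y i} → i ∈ cupsAt f y → f i ≡ y
  ∈-cupsAt⁻ = ∈-subset⁻ _

  χ : Subset m → Fin m → ℚ
  χ S i = if lookup S i then 1ℚ else 0ℚ

  χ-∈ : ∀ {S : Subset m} {i} → i ∈ S → χ S i ≡ 1ℚ
  χ-∈ i∈S rewrite []=⇒lookup i∈S = refl

  χ-∉ : ∀ {S : Subset m} {i} → i ∉ S → χ S i ≡ 0ℚ
  χ-∉ {S = S} {i} i∉S with lookup S i in eq
  ... | true  = ⊥-elim (i∉S (lookup⇒[]= i S eq))
  ... | false = refl

  module ℚΣ = SemiringSum (Ring.semiring +-*-ring)

  sumℚ≡sum : ∀ (a : Fin m → ℚ) → sumℚ a ≡ ℚΣ.sum a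
  sumℚ≡sum {zero}  a = refl
  sumℚ≡sum {suc m} a = cong (a zero +_) (sumℚ≡sum (a ∘ suc))

  sumℚ-+ : ∀ (a b : Fin m → ℚ) → sumℚ (λ i → a i + b i) ≡ sumℚ a + sumℚ b
  sumℚ-+ a b = begin
    sumℚ (λ i → a i + b i)      ≡⟨ sumℚ≡sum (λ i → a i + b i) ⟩
    ℚΣ.sum (λ i → a i + b i)    ≡⟨ ℚΣ.∑-distrib-+ a b ⟩
    ℚΣ.sum a + ℚΣ.sum b         ≡⟨ cong₂ _+_ (sumℚ≡sum a) (sumℚ≡sum b) ⟨
    sumℚ a + sumℚ b             ∎
    where open ≡-Reasoning

  sumℚ-*ˡ : ∀ q (a : Fin m → ℚ) → sumℚ (λ i → q * a i) ≡ q * sumℚ a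
  sumℚ-*ˡ q a = begin
    sumℚ (λ i → q * a i)        ≡⟨ sumℚ≡sum (λ i → q * a i) ⟩
    ℚΣ.sum (λ i → q * a i)      ≡⟨ ℚΣ.*-distribˡ-sum q a ⟨
    q * ℚΣ.sum a                ≡⟨ cong (q *_) (sumℚ≡sum a) ⟨
    q * sumℚ a                  ∎
    where open ≡-Reasoning

  sumℚ-χ : ∀ (S : Subset m) → sumℚ (χ S) ≡ ℕ→ℚ ∣ S ∣
  sumℚ-χ []            = refl
  sumℚ-χ (inside  ∷ S) = trans (cong (1ℚ +_) (sumℚ-χ S)) (sym (Rationals.ℕ→ℚ-+ 1 ∣ S ∣))
  sumℚ-χ (outside ∷ S) = trans (+-identityˡ _) (sumℚ-χ S)

  empty-∈ : ∀ (g : Fills m) {S i} → i ∈ S → empty g S i ≡ g i - 1ℚ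
  empty-∈ g i∈S rewrite []=⇒lookup i∈S = refl

  empty-∉ : ∀ (g : Fills m) {S i} → i ∉ S → empty g S i ≡ g i
  empty-∉ g {S} {i} i∉S with lookup S i in eq
  ... | true  = ⊥-elim (i∉S (lookup⇒[]= i S eq))
  ... | false = refl

module Game where

  open import Data.Nat using (ℕ; zero; suc)
  open import Data.Fin using (Fin)
  open import Data.Rational using (ℚ)
  open import Data.Product using (Σ; _×_; _,_)
  open import Data.Sum using (inj₁; inj₂)

  private variable
    m : ℕ

  OneRound : (Fills m → Set) → Fills m → Set
  OneRound R f = Σ ℕ λ p → Σ (Fin _ → ℚ) λ a → ValidFill p a ×
    (∀ S → GreedyChoice (addFill f a) p S → R (empty (addFill f a) S))

  CanForce-now : ∀ t {G : Fills m → Set} {f} → G f → CanForce t G f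
  CanForce-now zero    Gf = Gf
  CanForce-now (suc t) Gf = inj₁ Gf

  CanForce-mono : ∀ t {G G′ : Fills m → Set} → (∀ {f} → G f → G′ f) → ∀ {f} → CanForce t G f → CanForce t G′ f
  CanForce-mono zero    G⇒G′ Gf                          = G⇒G′ Gf
  CanForce-mono (suc t) G⇒G′ (inj₁ Gf)                   = inj₁ (G⇒G′ Gf)
  CanForce-mono (suc t) G⇒G′ (inj₂ (p , a , valid , next)) =
    inj₂ (p , a , valid , λ S greedy → CanForce-mono t G⇒G′ (next S greedy))

  CanForce-suc : ∀ t {G R : Fills m → Set} {f} → OneRound R f → (∀ {g} → R g → CanForce t G g) →
    CanForce (suc t) G f
  CanForce-suc t (p , a , valid , R-after) R⇒G = inj₂ (p , a , valid , λ S greedy → R⇒G (R-after S greedy))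

module Round where

  open Subsets
  open Rationals
  open Cups
  open Game using (OneRound)
  open import Data.Nat as ℕ using (ℕ)
  import Data.Nat.Properties as ℕ
  open import Data.Fin using (Fin)
  open import Data.Fin.Subset hiding (_-_)
  open import Data.Fin.Subset.Properties
  open import Data.Rational as ℚ using (ℚ; 0ℚ; 1ℚ; ½; _+_; _-_; _*_; _<_; _≤_)
  open import Data.Rational.Properties as ℚ using ()
  open import Data.Product using (_×_; _,_; proj₁; proj₂)
  open import Data.Sum using (inj₁; inj₂; [_,_])
  open import Data.Empty using (⊥-elim)
  open import Function using (_∘_)
  open import Relation.Nullary using (yes; no)
  open import Relation.Nullary.Decidable using (toWitness)
  open import Relation.Binary.PropositionalEquality hiding ([_])

  record SplitAt {n} (x : ℚ) (u : ℕ) (f g : Fills n) : Set where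
    field
      elsewhere : ∀ y → y ≢ x → countEq f y ℕ.≤ countEq g y
      at        : countEq f x ℕ.≤ countEq g x ℕ.+ 2 ℕ.* u
      above     : countEq f (x + ½) ℕ.+ u ℕ.≤ countEq g (x + ½)
      below     : countEq f (x - ½) ℕ.+ u ℕ.≤ countEq g (x - ½)

  module Move {n} (f : Fills n) (x : ℚ) (u : ℕ) (u≥1 : 1 ℕ.≤ u)
              (X : Subset n) (X-at-x : ∀ {i} → i ∈ X → f i ≡ x) (∣X∣≡2u : ∣ X ∣ ≡ 2 ℕ.* u) where

    H : Subset n
    H = subset (λ i → x ℚ.<? f i)

    ∈H⁻ : ∀ {i} → i ∈ H → x < f i
    ∈H⁻ = ∈-subset⁻ _

    ∉H⁻ : ∀ {i} → i ∉ H → f i ≤ x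
    ∉H⁻ i∉H = ℚ.≮⇒≥ (i∉H ∘ ∈-subset⁺ _)

    ∈H⇒∉X : ∀ {i} → i ∈ H → i ∉ X
    ∈H⇒∉X i∈H i∈X = ℚ.<-irrefl (sym (X-at-x i∈X)) (∈H⁻ i∈H)

    H∩X-empty : Empty (H ∩ X)
    H∩X-empty (i , i∈H∩X) with x∈p∩q⁻ H X i∈H∩X
    ... | i∈H , i∈X = ∈H⇒∉X i∈H i∈X

    ∣X∣≡u+u : ∣ X ∣ ≡ u ℕ.+ u
    ∣X∣≡u+u = trans ∣X∣≡2u (cong (u ℕ.+_) (ℕ.+-identityʳ u))

    a : Fin n → ℚ
    a i = χ H i + ½ * χ X i

    -- This many processors make the greedy emptier take all of H and exactly u cups of X.
    p : ℕ
    p = ∣ H ∣ ℕ.+ u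

    a-H : ∀ {i} → i ∈ H → a i ≡ 1ℚ
    a-H i∈H rewrite χ-∈ i∈H | χ-∉ (∈H⇒∉X i∈H) = refl

    a-X : ∀ {i} → i ∈ X → a i ≡ ½
    a-X i∈X rewrite χ-∈ i∈X | χ-∉ (λ i∈H → ∈H⇒∉X i∈H i∈X) = refl

    a-rest : ∀ {i} → i ∉ H → i ∉ X → a i ≡ 0ℚ
    a-rest i∉H i∉X rewrite χ-∉ i∉H | χ-∉ i∉X = refl

    a∈[0,1] : ∀ i → (0ℚ ≤ a i) × (a i ≤ 1ℚ)
    a∈[0,1] i with i ∈? H | i ∈? X
    ... | yes i∈H | _       rewrite a-H i∈H =
      toWitness {a? = 0ℚ ℚ.≤? 1ℚ} _ , ℚ.≤-refl
    ... | no  i∉H | yes i∈X rewrite a-X i∈X =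
      toWitness {a? = 0ℚ ℚ.≤? ½} _ , toWitness {a? = ½ ℚ.≤? 1ℚ} _
    ... | no  i∉H | no  i∉X rewrite a-rest i∉H i∉X =
      ℚ.≤-refl , toWitness {a? = 0ℚ ℚ.≤? 1ℚ} _

    sum-a : sumℚ a ≡ ℕ→ℚ p
    sum-a = begin
      sumℚ a                               ≡⟨ sumℚ-+ (χ H) (λ i → ½ * χ X i) ⟩
      sumℚ (χ H) + sumℚ (λ i → ½ * χ X i)  ≡⟨ cong (sumℚ (χ H) +_) (sumℚ-*ˡ ½ (χ X)) ⟩
      sumℚ (χ H) + ½ * sumℚ (χ X)          ≡⟨ cong₂ (λ s t → s + ½ * t) (sumℚ-χ H) (sumℚ-χ X) ⟩
      ℕ→ℚ ∣ H ∣ + ½ * ℕ→ℚ ∣ X ∣            ≡⟨ cong (λ t → ℕ→ℚ ∣ H ∣ + ½ * ℕ→ℚ t) ∣X∣≡u+u ⟩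
      ℕ→ℚ ∣ H ∣ + ½ * ℕ→ℚ (u ℕ.+ u)        ≡⟨ cong (λ t → ℕ→ℚ ∣ H ∣ + ½ * t) (ℕ→ℚ-+ u u) ⟩
      ℕ→ℚ ∣ H ∣ + ½ * (ℕ→ℚ u + ℕ→ℚ u)      ≡⟨ cong (ℕ→ℚ ∣ H ∣ +_) (½*[p+p]≡p (ℕ→ℚ u)) ⟩
      ℕ→ℚ ∣ H ∣ + ℕ→ℚ u                    ≡⟨ ℕ→ℚ-+ ∣ H ∣ u ⟨
      ℕ→ℚ p                                ∎
      where open ≡-Reasoning

    p≤∣H∪X∣ : p ℕ.≤ ∣ H ∪ X ∣
    p≤∣H∪X∣ = begin
      ∣ H ∣ ℕ.+ u            ≤⟨ ℕ.+-monoʳ-≤ ∣ H ∣ (ℕ.m≤m+n u u) ⟩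
      ∣ H ∣ ℕ.+ (u ℕ.+ u)    ≡⟨ cong (∣ H ∣ ℕ.+_) ∣X∣≡u+u ⟨
      ∣ H ∣ ℕ.+ ∣ X ∣        ≡⟨ ∣p∪q∣≡∣p∣+∣q∣ H X H∩X-empty ⟨
      ∣ H ∪ X ∣              ∎
      where open ℕ.≤-Reasoning

    valid : ValidFill p a
    valid = ℕ.≤-trans u≥1 (ℕ.m≤n+m u ∣ H ∣) , ℕ.≤-trans p≤∣H∪X∣ (∣p∣≤n (H ∪ X)) , a∈[0,1] , sum-a

    P : Fills n
    P = addFill f a

    P-H : ∀ {i} → i ∈ H → P i ≡ f i + 1ℚ
    P-H i∈H = cong (f _ +_) (a-H i∈H)

    P-X : ∀ {i} → i ∈ X → P i ≡ x + ½
    P-X i∈X = cong₂ _+_ (X-at-x i∈X) (a-X i∈X)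

    P-rest : ∀ {i} → i ∉ H → i ∉ X → P i ≡ f i
    P-rest i∉H i∉X = trans (cong (f _ +_) (a-rest i∉H i∉X)) (ℚ.+-identityʳ _)

    x+1<P : ∀ {i} → i ∈ H → x + 1ℚ < P i
    x+1<P i∈H = subst (x + 1ℚ <_) (sym (P-H i∈H)) (ℚ.+-monoˡ-< 1ℚ (∈H⁻ i∈H))

    P<x+1 : ∀ {i} → i ∉ H → P i < x + 1ℚ
    P<x+1 {i} i∉H with i ∈? X
    ... | yes i∈X = subst (_< x + 1ℚ) (sym (P-X i∈X)) (p+½<p+1 x)
    ... | no  i∉X = subst (_< x + 1ℚ) (sym (P-rest i∉H i∉X))
                      (ℚ.≤-<-trans (∉H⁻ i∉H) (ℚ.<-trans (p<p+½ x) (p+½<p+1 x)))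

    module Response (S : Subset n) (greedy : GreedyChoice P p S) where

      ∣S∣≡p : ∣ S ∣ ≡ p
      ∣S∣≡p = proj₁ greedy

      P-greedy : ∀ {i j} → i ∈ S → j ∉ S → P j ≤ P i
      P-greedy i∈S j∉S = proj₂ greedy _ _ i∈S j∉S

      H⊆S : H ⊆ S
      H⊆S {h} h∈H with h ∈? S
      ... | yes h∈S = h∈S
      ... | no  h∉S = ⊥-elim (ℕ.<⇒≱ (p⊂q⇒∣p∣<∣q∣ (S⊆H , h , h∈H , h∉S)) ∣H∣≤∣S∣)
        where
        S⊆H : S ⊆ H
        S⊆H {i} i∈S with i ∈? H
        ... | yes i∈H = i∈H
        ... | no  i∉H = ⊥-elim (<⇒≱ (ℚ.<-trans (P<x+1 i∉H) (x+1<P h∈H)) (P-greedy i∈S h∉S))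
        ∣H∣≤∣S∣ : ∣ H ∣ ℕ.≤ ∣ S ∣
        ∣H∣≤∣S∣ = subst (∣ H ∣ ℕ.≤_) (sym ∣S∣≡p) (ℕ.m≤m+n ∣ H ∣ u)

      S⊆H∪X : ∀ {i} → i ∈ S → i ∉ H → i ∈ X
      S⊆H∪X {i} i∈S i∉H with i ∈? X
      ... | yes i∈X = i∈X
      ... | no  i∉X = ⊥-elim (ℕ.<⇒≱ (p⊂q⇒∣p∣<∣q∣ (H∪X⊆S , i , i∈S , i∉H∪X))
                                     (subst (ℕ._≤ ∣ H ∪ X ∣) (sym ∣S∣≡p) p≤∣H∪X∣))
        where
        X⊆S : X ⊆ S
        X⊆S {j} j∈X with j ∈? S
        ... | yes j∈S = j∈S
        ... | no  j∉S = ⊥-elim (<⇒≱ (subst (x <_) (sym (P-X j∈X)) (p<p+½ x)) (begin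
          P j  ≤⟨ P-greedy i∈S j∉S ⟩
          P i  ≡⟨ P-rest i∉H i∉X ⟩
          f i  ≤⟨ ∉H⁻ i∉H ⟩
          x    ∎))
          where open ℚ.≤-Reasoning
        H∪X⊆S : H ∪ X ⊆ S
        H∪X⊆S j∈H∪X = [ H⊆S , X⊆S ] (x∈p∪q⁻ H X j∈H∪X)
        i∉H∪X : i ∉ H ∪ X
        i∉H∪X i∈H∪X = [ i∉H , i∉X ] (x∈p∪q⁻ H X i∈H∪X)

      S≡H∪X∩S : S ≡ H ∪ (X ∩ S)
      S≡H∪X∩S = ⊆-antisym S⊆ ⊆S
        where
        S⊆ : S ⊆ H ∪ (X ∩ S)
        S⊆ {i} i∈S with i ∈? H
        ... | yes i∈H = x∈p∪q⁺ (inj₁ i∈H)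
        ... | no  i∉H = x∈p∪q⁺ (inj₂ (x∈p∩q⁺ (S⊆H∪X i∈S i∉H , i∈S)))
        ⊆S : H ∪ (X ∩ S) ⊆ S
        ⊆S i∈ = [ H⊆S , proj₂ ∘ x∈p∩q⁻ X S ] (x∈p∪q⁻ H (X ∩ S) i∈)

      ∣X∩S∣≡u : ∣ X ∩ S ∣ ≡ u
      ∣X∩S∣≡u = ℕ.+-cancelˡ-≡ ∣ H ∣ _ _ (begin
        ∣ H ∣ ℕ.+ ∣ X ∩ S ∣  ≡⟨ ∣p∪q∣≡∣p∣+∣q∣ H (X ∩ S) disjoint ⟨
        ∣ H ∪ (X ∩ S) ∣      ≡⟨ cong ∣_∣ S≡H∪X∩S ⟨
        ∣ S ∣                ≡⟨ ∣S∣≡p ⟩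
        ∣ H ∣ ℕ.+ u          ∎)
        where
        open ≡-Reasoning
        disjoint : Empty (H ∩ (X ∩ S))
        disjoint (i , i∈) with x∈p∩q⁻ H (X ∩ S) i∈
        ... | i∈H , i∈X∩S = ∈H⇒∉X i∈H (proj₁ (x∈p∩q⁻ X S i∈X∩S))

      ∣X∩∁S∣≡u : ∣ X ∩ ∁ S ∣ ≡ u
      ∣X∩∁S∣≡u = ℕ.+-cancelˡ-≡ u _ _ (begin
        u ℕ.+ ∣ X ∩ ∁ S ∣          ≡⟨ cong (ℕ._+ ∣ X ∩ ∁ S ∣) ∣X∩S∣≡u ⟨
        ∣ X ∩ S ∣ ℕ.+ ∣ X ∩ ∁ S ∣  ≡⟨ ∣p∩q∣+∣p∩∁q∣≡∣p∣ X S ⟩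
        ∣ X ∣                      ≡⟨ ∣X∣≡u+u ⟩
        u ℕ.+ u                    ∎)
        where open ≡-Reasoning

      g : Fills n
      g = empty P S

      g-off-X : ∀ {i} → i ∉ X → g i ≡ f i
      g-off-X {i} i∉X with i ∈? H
      ... | yes i∈H = begin
        g i            ≡⟨ empty-∈ P (H⊆S i∈H) ⟩
        P i - 1ℚ       ≡⟨ cong (_- 1ℚ) (P-H i∈H) ⟩
        f i + 1ℚ - 1ℚ  ≡⟨ p+1-1≡p (f i) ⟩
        f i            ∎
        where open ≡-Reasoning
      ... | no  i∉H = trans (empty-∉ P (λ i∈S → i∉X (S⊆H∪X i∈S i∉H))) (P-rest i∉H i∉X)

      g-X∩S : ∀ {i} → i ∈ X ∩ S → g i ≡ x - ½
      g-X∩S {i} i∈ with x∈p∩q⁻ X S i∈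
      ... | i∈X , i∈S = begin
        g i            ≡⟨ empty-∈ P i∈S ⟩
        P i - 1ℚ       ≡⟨ cong (_- 1ℚ) (P-X i∈X) ⟩
        x + ½ - 1ℚ     ≡⟨ p+½-1≡p-½ x ⟩
        x - ½          ∎
        where open ≡-Reasoning

      g-X∩∁S : ∀ {i} → i ∈ X ∩ ∁ S → g i ≡ x + ½
      g-X∩∁S i∈ with x∈p∩q⁻ X (∁ S) i∈
      ... | i∈X , i∈∁S = trans (empty-∉ P (x∈∁p⇒x∉p i∈∁S)) (P-X i∈X)

      gain : ∀ {T y} → y ≢ x → T ⊆ X → (∀ {i} → i ∈ T → g i ≡ y) → countEq f y ℕ.+ ∣ T ∣ ℕ.≤ countEq g y
      gain {T} {y} y≢x T⊆X g≡y rewrite countEq≡∣cupsAt∣ f y | countEq≡∣cupsAt∣ g y = begin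
        ∣ cupsAt f y ∣ ℕ.+ ∣ T ∣  ≡⟨ ∣p∪q∣≡∣p∣+∣q∣ (cupsAt f y) T disjoint ⟨
        ∣ cupsAt f y ∪ T ∣        ≤⟨ p⊆q⇒∣p∣≤∣q∣ ∪⊆ ⟩
        ∣ cupsAt g y ∣            ∎
        where
        open ℕ.≤-Reasoning
        at-y⇒∉X : ∀ {i} → i ∈ cupsAt f y → i ∉ X
        at-y⇒∉X i∈ i∈X = y≢x (trans (sym (∈-cupsAt⁻ i∈)) (X-at-x i∈X))
        disjoint : Empty (cupsAt f y ∩ T)
        disjoint (i , i∈) with x∈p∩q⁻ (cupsAt f y) T i∈
        ... | i∈fy , i∈T = at-y⇒∉X i∈fy (T⊆X i∈T)
        ∪⊆ : cupsAt f y ∪ T ⊆ cupsAt g y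
        ∪⊆ i∈ = [ (λ i∈fy → ∈-cupsAt⁺ (trans (g-off-X (at-y⇒∉X i∈fy)) (∈-cupsAt⁻ i∈fy)))
                , ∈-cupsAt⁺ ∘ g≡y ] (x∈p∪q⁻ (cupsAt f y) T i∈)

      at-x : countEq f x ℕ.≤ countEq g x ℕ.+ 2 ℕ.* u
      at-x rewrite countEq≡∣cupsAt∣ f x | countEq≡∣cupsAt∣ g x = begin
        ∣ cupsAt f x ∣               ≤⟨ p⊆q⇒∣p∣≤∣q∣ ⊆∪ ⟩
        ∣ cupsAt g x ∪ X ∣           ≤⟨ ∣p∪q∣≤∣p∣+∣q∣ (cupsAt g x) X ⟩
        ∣ cupsAt g x ∣ ℕ.+ ∣ X ∣     ≡⟨ cong (∣ cupsAt g x ∣ ℕ.+_) ∣X∣≡2u ⟩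
        ∣ cupsAt g x ∣ ℕ.+ 2 ℕ.* u   ∎
        where
        open ℕ.≤-Reasoning
        ⊆∪ : cupsAt f x ⊆ cupsAt g x ∪ X
        ⊆∪ {i} i∈ with i ∈? X
        ... | yes i∈X = x∈p∪q⁺ (inj₂ i∈X)
        ... | no  i∉X = x∈p∪q⁺ (inj₁ (∈-cupsAt⁺ (trans (g-off-X i∉X) (∈-cupsAt⁻ i∈))))

      outcome : SplitAt x u f g
      outcome = record
        { elsewhere = λ y y≢x → ℕ.≤-trans (ℕ.m≤m+n _ _) (gain y≢x (⊆-min X) (⊥-elim ∘ ∉⊥))
        ; at        = at-x
        ; above     = subst (λ t → countEq f (x + ½) ℕ.+ t ℕ.≤ countEq g (x + ½)) ∣X∩∁S∣≡u
                        (gain (λ e → ℚ.<⇒≢ (p<p+½ x) (sym e)) (p∩q⊆p X (∁ S)) g-X∩∁S)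
        ; below     = subst (λ t → countEq f (x - ½) ℕ.+ t ℕ.≤ countEq g (x - ½)) ∣X∩S∣≡u
                        (gain (ℚ.<⇒≢ (p-½<p x)) (p∩q⊆p X S) g-X∩S)
        }

  split-round : ∀ {n} (f : Fills n) x u → 1 ℕ.≤ u → 2 ℕ.* u ℕ.≤ countEq f x → OneRound (SplitAt x u f) f
  split-round f x u u≥1 2u≤
    with subset-of-size (cupsAt f x) (subst (2 ℕ.* u ℕ.≤_) (countEq≡∣cupsAt∣ f x) 2u≤)
  ... | X , X⊆ , ∣X∣≡2u = p , a , valid , Response.outcome
    where open Move f x u u≥1 X (∈-cupsAt⁻ ∘ X⊆) ∣X∣≡2u

module Tokens where

  import Algebra.Properties.Semiring.Sum as SemiringSum
  open import Data.Nat
  open import Data.Nat.Properties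
  open import Data.Nat.Tactic.RingSolver using (solve-∀)
  open import Data.Fin using (toℕ)
  open import Data.Empty using (⊥-elim)
  open import Function using (_∘_)
  open import Relation.Nullary using (yes; no)
  open import Relation.Binary.PropositionalEquality

  module ℕΣ = SemiringSum +-*-semiring

  Σ< : ℕ → (ℕ → ℕ) → ℕ
  Σ< L g = ℕΣ.sum {L} (λ i → g (toℕ i))

  Σ<-cong : ∀ L {g h : ℕ → ℕ} → (∀ w → g w ≡ h w) → Σ< L g ≡ Σ< L h
  Σ<-cong L g≗h = ℕΣ.sum-cong-≗ {L} (g≗h ∘ toℕ)

  Σ<-+ : ∀ L (g h : ℕ → ℕ) → Σ< L (λ w → g w + h w) ≡ Σ< L g + Σ< L h
  Σ<-+ L g h = ℕΣ.∑-distrib-+ {L} (g ∘ toℕ) (h ∘ toℕ)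

  Σ<-* : ∀ L a (g : ℕ → ℕ) → Σ< L (λ w → a * g w) ≡ a * Σ< L g
  Σ<-* L a g = sym (ℕΣ.*-distribˡ-sum {L} a (g ∘ toℕ))

  Σ<-zero : ∀ L → Σ< L (λ _ → 0) ≡ 0
  Σ<-zero = ℕΣ.sum-replicate-zero

  Σ<-mono : ∀ L {g h : ℕ → ℕ} → (∀ w → w < L → g w ≤ h w) → Σ< L g ≤ Σ< L h
  Σ<-mono zero    g≤h = z≤n
  Σ<-mono (suc L) g≤h = +-mono-≤ (g≤h 0 z<s) (Σ<-mono L (λ w w<L → g≤h (suc w) (s<s w<L)))

  Σ<-last : ∀ L (g : ℕ → ℕ) → Σ< (suc L) g ≡ Σ< L g + g L
  Σ<-last zero    g = +-comm (g 0) 0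
  Σ<-last (suc L) g = trans (cong (g 0 +_) (Σ<-last L (g ∘ suc))) (sym (+-assoc (g 0) _ _))

  point : ℕ → ℕ → ℕ → ℕ
  point zero    a zero    = a
  point zero    a (suc w) = 0
  point (suc t) a zero    = 0
  point (suc t) a (suc w) = point t a w

  point-self : ∀ t a → point t a t ≡ a
  point-self zero    a = refl
  point-self (suc t) a = point-self t a

  point-elsewhere : ∀ t a w → w ≢ t → point t a w ≡ 0
  point-elsewhere zero    a zero    w≢t = ⊥-elim (w≢t refl)
  point-elsewhere zero    a (suc w) _   = refl
  point-elsewhere (suc t) a zero    _   = refl
  point-elsewhere (suc t) a (suc w) w≢t = point-elsewhere t a w (w≢t ∘ cong suc)

  Σ<-point : ∀ {L t} (h : ℕ → ℕ) a → t < L → Σ< L (λ w → h w * point t a w) ≡ h t * a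
  Σ<-point {suc L} {zero}  h a _         = begin
    h 0 * a + Σ< L (λ w → h (suc w) * 0)  ≡⟨ cong (h 0 * a +_) (Σ<-cong L (*-zeroʳ ∘ h ∘ suc)) ⟩
    h 0 * a + Σ< L (λ _ → 0)              ≡⟨ cong (h 0 * a +_) (Σ<-zero L) ⟩
    h 0 * a + 0                           ≡⟨ +-identityʳ _ ⟩
    h 0 * a                               ∎
    where open ≡-Reasoning
  Σ<-point {suc L} {suc t} h a (s<s t<L) =
    trans (cong (_+ Σ< L (λ w → h (suc w) * point t a w)) (*-zeroʳ (h 0))) (Σ<-point (h ∘ suc) a t<L)

  split : ℕ → (ℕ → ℕ) → ℕ → ℕ
  split zero    c zero                = c 0 + 1
  split zero    c (suc zero)          = c 1 ∸ 2
  split zero    c (suc (suc zero))    = c 2 + 1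
  split zero    c (suc (suc (suc w))) = c (suc (suc (suc w)))
  split (suc v) c zero                = c 0
  split (suc v) c (suc w)             = split v (c ∘ suc) w

  split-below : ∀ v c → split v c v ≡ c v + 1
  split-below zero    c = refl
  split-below (suc v) c = split-below v (c ∘ suc)

  split-middle : ∀ v c → 2 ≤ c (suc v) → split v c (suc v) + 2 ≡ c (suc v)
  split-middle zero    c 2≤c₁ = m∸n+n≡m 2≤c₁
  split-middle (suc v) c 2≤c  = split-middle v (c ∘ suc) 2≤c

  split-above : ∀ v c → split v c (suc (suc v)) ≡ c (suc (suc v)) + 1
  split-above zero    c = refl
  split-above (suc v) c = split-above v (c ∘ suc)

  split-elsewhere : ∀ v c w → w ≢ v → w ≢ suc v → w ≢ suc (suc v) → split v c w ≡ c w
  split-elsewhere zero    c zero                w≢0 _   _   = ⊥-elim (w≢0 refl)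
  split-elsewhere zero    c (suc zero)          _   w≢1 _   = ⊥-elim (w≢1 refl)
  split-elsewhere zero    c (suc (suc zero))    _   _   w≢2 = ⊥-elim (w≢2 refl)
  split-elsewhere zero    c (suc (suc (suc w))) _   _   _   = refl
  split-elsewhere (suc v) c zero                _   _   _   = refl
  split-elsewhere (suc v) c (suc w) w≢v w≢v+1 w≢v+2 =
    split-elsewhere v (c ∘ suc) w (w≢v ∘ cong suc) (w≢v+1 ∘ cong suc) (w≢v+2 ∘ cong suc)

  Σ<-split : ∀ v {L} c (h : ℕ → ℕ) → 2 ≤ c (suc v) → suc (suc v) < L →
    Σ< L (λ w → h w * split v c w) + 2 * h (suc v) ≡ Σ< L (λ w → h w * c w) + h v + h (suc (suc v))
  Σ<-split zero {suc (suc (suc L))} c h 2≤c₁ _ =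
    trans (rearrange (h 0) (h 1) (h 2) (c 0) (c 1 ∸ 2) (c 2) rest)
          (cong (λ c₁ → h 0 * c 0 + (h 1 * c₁ + (h 2 * c 2 + rest)) + h 0 + h 2) (m∸n+n≡m 2≤c₁))
    where
    rest = Σ< L (λ w → h (3 + w) * c (3 + w))
    rearrange : ∀ h₀ h₁ h₂ c₀ m c₂ r →
      h₀ * (c₀ + 1) + (h₁ * m + (h₂ * (c₂ + 1) + r)) + 2 * h₁ ≡
      h₀ * c₀ + (h₁ * (m + 2) + (h₂ * c₂ + r)) + h₀ + h₂
    rearrange = solve-∀
  Σ<-split zero {1} c h _ (s<s ())
  Σ<-split zero {2} c h _ (s<s (s<s ()))
  Σ<-split (suc v) {suc L} c h 2≤c (s<s v+2<L) = begin
    h 0 * c 0 + Σ< L (λ w → h (suc w) * split v (c ∘ suc) w) + 2 * h (suc (suc v))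
      ≡⟨ +-assoc (h 0 * c 0) _ _ ⟩
    h 0 * c 0 + (Σ< L (λ w → h (suc w) * split v (c ∘ suc) w) + 2 * h (suc (suc v)))
      ≡⟨ cong (h 0 * c 0 +_) (Σ<-split v (c ∘ suc) (h ∘ suc) 2≤c v+2<L) ⟩
    h 0 * c 0 + (Σ< L (λ w → h (suc w) * c (suc w)) + h (suc v) + h (suc (suc (suc v))))
      ≡⟨ reassoc (h 0 * c 0) _ _ _ ⟩
    h 0 * c 0 + Σ< L (λ w → h (suc w) * c (suc w)) + h (suc v) + h (suc (suc (suc v))) ∎
    where
    open ≡-Reasoning
    reassoc : ∀ a b d e → a + (b + d + e) ≡ a + b + d + e
    reassoc = solve-∀

  Σ<-split-moment : ∀ v {L} c (h : ℕ → ℕ) e → 2 ≤ c (suc v) → suc (suc v) < L →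
    h v + h (suc (suc v)) ≡ 2 * h (suc v) + e →
    Σ< L (λ w → h w * split v c w) ≡ Σ< L (λ w → h w * c w) + e
  Σ<-split-moment v {L} c h e 2≤c v+2<L h-convex = +-cancelʳ-≡ (2 * h (suc v)) _ _ (begin
    Σsplit + 2 * h (suc v)           ≡⟨ Σ<-split v c h 2≤c v+2<L ⟩
    Σc + h v + h (suc (suc v))       ≡⟨ +-assoc Σc (h v) _ ⟩
    Σc + (h v + h (suc (suc v)))     ≡⟨ cong (Σc +_) h-convex ⟩
    Σc + (2 * h (suc v) + e)         ≡⟨ swap Σc (2 * h (suc v)) e ⟩
    Σc + e + 2 * h (suc v)           ∎)
    where
    open ≡-Reasoning
    Σsplit = Σ< L (λ w → h w * split v c w)
    Σc     = Σ< L (λ w → h w * c w)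
    swap : ∀ a b d → a + (b + d) ≡ a + d + b
    swap = solve-∀

  Σ<-triangular : ∀ L (d : ℕ → ℕ) → (∀ v → v < L → d v ≤ 1) →
    Σ< L d * suc (Σ< L d) ≤ 2 * Σ< L (λ v → suc v * d v)
  Σ<-triangular zero    d d≤1 = z≤n
  Σ<-triangular (suc L) d d≤1 = begin
    (d 0 + N) * suc (d 0 + N)                             ≤⟨ step (d 0) (d≤1 0 z<s) ⟩
    2 * (d 0 + (N + S))                                   ≡⟨ cong (2 *_) (cong₂ _+_ (*-identityˡ (d 0)) Σ<-weights) ⟨
    2 * (1 * d 0 + Σ< L (λ v → suc (suc v) * d (suc v)))  ∎
    where
    open ≤-Reasoning
    N = Σ< L (d ∘ suc)
    S = Σ< L (λ v → suc v * d (suc v))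
    Σ<-weights : Σ< L (λ v → suc (suc v) * d (suc v)) ≡ N + S
    Σ<-weights = Σ<-+ L (d ∘ suc) (λ v → suc v * d (suc v))
    IH : N * suc N ≤ 2 * S
    IH = Σ<-triangular L (d ∘ suc) (λ v v<L → d≤1 (suc v) (s<s v<L))
    expand : ∀ n → suc n * suc (suc n) ≡ n * suc n + 2 * suc n
    expand = solve-∀
    collect : ∀ n s → 2 * s + 2 * suc n ≡ 2 * (1 + (n + s))
    collect = solve-∀
    step : ∀ a → a ≤ 1 → (a + N) * suc (a + N) ≤ 2 * (a + (N + S))
    step 0 _ = ≤-trans IH (*-monoʳ-≤ 2 (m≤n+m S N))
    step 1 _ = begin
      suc N * suc (suc N)    ≡⟨ expand N ⟩
      N * suc N + 2 * suc N  ≤⟨ +-monoˡ-≤ (2 * suc N) IH ⟩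
      2 * S + 2 * suc N      ≡⟨ collect N S ⟩
      2 * (1 + (N + S))      ∎
    step (2+ _) (s≤s ())

  Σ<-triangular-top : ∀ L (d : ℕ → ℕ) → (∀ v → v < L → d v ≤ 1) → Σ< (suc L) d ≤ L →
    Σ< (suc L) d * suc (Σ< (suc L) d) ≤ 2 * Σ< (suc L) (λ v → suc v * d v)
  Σ<-triangular-top L d d≤1 N≤L
    rewrite Σ<-last L d | Σ<-last L (λ v → suc v * d v) = begin
    (N + x) * suc (N + x)             ≡⟨ expand N x ⟩
    N * suc N + x * (N + N + x + 1)   ≤⟨ +-mono-≤ (Σ<-triangular L d d≤1) (*-monoʳ-≤ x N+N+x+1≤2+2L) ⟩
    2 * S + x * (2 * suc L)           ≡⟨ collect S x L ⟩
    2 * (S + suc L * x)               ∎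
    where
    open ≤-Reasoning
    N = Σ< L d
    S = Σ< L (λ v → suc v * d v)
    x = d L
    expand : ∀ n y → (n + y) * suc (n + y) ≡ n * suc n + y * (n + n + y + 1)
    expand = solve-∀
    collect : ∀ s y l → 2 * s + y * (2 * suc l) ≡ 2 * (s + suc l * y)
    collect = solve-∀
    double : ∀ l → l + l + 1 + 1 ≡ 2 * suc l
    double = solve-∀
    N+N+x+1≤2+2L : N + N + x + 1 ≤ 2 * suc L
    N+N+x+1≤2+2L = begin
      N + N + x + 1    ≡⟨ cong (_+ 1) (+-assoc N N x) ⟩
      N + (N + x) + 1  ≤⟨ +-monoˡ-≤ 1 (+-mono-≤ (≤-trans (m≤m+n N x) N≤L) N≤L) ⟩
      L + L + 1        ≤⟨ m≤m+n (L + L + 1) 1 ⟩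
      L + L + 1 + 1    ≡⟨ double L ⟩
      2 * suc L        ∎

  sparse⇒k≤c₀ : ∀ k (c : ℕ → ℕ) → (∀ v → v < 4 * k → c (suc v) ≤ 1) →
    Σ< (2 + 4 * k) c ≡ 4 * k → Σ< (2 + 4 * k) (λ w → w * c w) ≡ k * (4 * k) → k ≤ c 0
  sparse⇒k≤c₀ k c c≤1 total moment with k ≤? c 0
  ... | yes k≤c₀ = k≤c₀
  ... | no  k≰c₀ = ⊥-elim (<⇒≱ too-heavy (begin
    suc (3 * k) * suc (suc (3 * k))               ≤⟨ *-mono-≤ 3k<N (s≤s 3k<N) ⟩
    N * suc N                                     ≤⟨ Σ<-triangular-top (4 * k) (c ∘ suc) c≤1 N≤4k ⟩
    2 * Σ< (1 + 4 * k) (λ v → suc v * c (suc v))  ≡⟨ cong (2 *_) moment ⟩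
    2 * (k * (4 * k))                             ∎))
    where
    open ≤-Reasoning
    N = Σ< (1 + 4 * k) (c ∘ suc)
    N≤4k : N ≤ 4 * k
    N≤4k = subst (N ≤_) total (m≤n+m N (c 0))
    split-4k : ∀ k → suc (4 * k) ≡ k + suc (3 * k)
    split-4k = solve-∀
    3k<N : 3 * k < N
    3k<N = +-cancelˡ-≤ k (suc (3 * k)) N (begin
      k + suc (3 * k)  ≡⟨ split-4k k ⟨
      suc (4 * k)      ≡⟨ cong suc total ⟨
      suc (c 0) + N    ≤⟨ +-monoˡ-≤ N (≰⇒> k≰c₀) ⟩
      k + N            ∎)
    expand : ∀ k → 2 * (k * (4 * k)) + suc (k * k + 9 * k + 1) ≡ suc (3 * k) * suc (suc (3 * k))
    expand = solve-∀
    too-heavy : 2 * (k * (4 * k)) < suc (3 * k) * suc (suc (3 * k))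
    too-heavy = subst (2 * (k * (4 * k)) <_) (expand k) (m<m+n _ z<s)

module Levels where

  open Rationals using (+-/-distrib; p-½<p; p-½+½≡p)
  open import Data.Nat as ℕ using (ℕ; zero; suc; s≤s)
  import Data.Nat.Properties as ℕ
  open import Data.Integer using (+_)
  open import Data.Rational as ℚ using (ℚ; 0ℚ; ½; _+_; _-_; _<_; _/_)
  open import Data.Rational.Properties as ℚ using ()
  open import Data.Rational.Solver using (module +-*-Solver)
  open import Data.Sum using (inj₁; inj₂)
  open import Relation.Nullary using (contradiction)
  open import Relation.Binary.Definitions using (tri<; tri≈; tri>)
  open import Relation.Binary.PropositionalEquality

  level : ℕ → ℕ → ℚ
  level k zero    = + k / 2
  level k (suc w) = level k w - ½

  level-suc+½ : ∀ k w → level k (suc w) + ½ ≡ level k w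
  level-suc+½ k w = p-½+½≡p (level k w)

  level≡k/2-w/2 : ∀ k w → level k w ≡ + k / 2 - + w / 2
  level≡k/2-w/2 k zero    = sym (ℚ.+-identityʳ (+ k / 2))
  level≡k/2-w/2 k (suc w) = begin
    level k w - ½              ≡⟨ cong (_- ½) (level≡k/2-w/2 k w) ⟩
    + k / 2 - + w / 2 - ½      ≡⟨ regroup (+ k / 2) (+ w / 2) ⟩
    + k / 2 - (½ + + w / 2)    ≡⟨ cong (λ h → + k / 2 - h) (+-/-distrib 1 w 2) ⟨
    + k / 2 - + suc w / 2      ∎
    where
    open ≡-Reasoning
    open +-*-Solver
    regroup : ∀ K W → K - W - ½ ≡ K - (½ + W)
    regroup = solve 2 (λ K W → K :- W :- con ½ := K :- (con ½ :+ W)) refl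

  level-self : ∀ k → level k k ≡ 0ℚ
  level-self k = trans (level≡k/2-w/2 k k) (ℚ.+-inverseʳ (+ k / 2))

  level-strictlyDecreasing : ∀ k {w v} → w ℕ.< v → level k v < level k w
  level-strictlyDecreasing k {w} {suc v} (s≤s w≤v) with ℕ.m≤n⇒m<n∨m≡n w≤v
  ... | inj₁ w<v  = ℚ.<-trans (p-½<p (level k v)) (level-strictlyDecreasing k w<v)
  ... | inj₂ refl = p-½<p (level k v)

  level-injective : ∀ k {w v} → level k w ≡ level k v → w ≡ v
  level-injective k {w} {v} eq with ℕ.<-cmp w v
  ... | tri< w<v _ _ = contradiction (sym eq) (ℚ.<⇒≢ (level-strictlyDecreasing k w<v))
  ... | tri≈ _ w≡v _ = w≡v
  ... | tri> _ _ v<w = contradiction eq (ℚ.<⇒≢ (level-strictlyDecreasing k v<w))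

module Strategy where

  open Game using (CanForce-now; CanForce-suc)
  open Round using (SplitAt; split-round)
  open Tokens
  open Levels
  open import Data.Nat
  open import Data.Nat.Properties
  open import Data.Nat.Tactic.RingSolver using (solve-∀)
  open import Data.Rational as ℚ using (0ℚ; ½)
  open import Data.Product using (∃; _×_; _,_)
  open import Data.Empty using (⊥-elim)
  open import Function using (_∘_)
  open import Relation.Nullary using (yes; no; ¬_)
  open import Relation.Binary.PropositionalEquality

  module _ {n : ℕ} (k u : ℕ) (u≥1 : 1 ≤ u) where

    top : ℕ
    top = suc (4 * k)

    record Balanced (c : ℕ → ℕ) : Set where
      field
        total  : Σ< (suc top) c ≡ 4 * k
        moment : Σ< (suc top) (λ w → w * c w) ≡ k * (4 * k)

    Represents : Fills n → (ℕ → ℕ) → Set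
    Represents f c = ∀ w → u * c w ≤ countEq f (level k w)

    energy : (ℕ → ℕ) → ℕ
    energy c = Σ< (suc top) (λ w → w * w * c w)

    max-energy : ℕ
    max-energy = 4 * k * (top * top)

    Goal : Fills n → Set
    Goal g = k * u ≤ countEq g (level k 0)

    energy-bounded : ∀ {c} → Balanced c → energy c ≤ max-energy
    energy-bounded {c} balanced = begin
      Σ< (suc top) (λ w → w * w * c w)      ≤⟨ Σ<-mono (suc top) w²c≤top²c ⟩
      Σ< (suc top) (λ w → top * top * c w)  ≡⟨ Σ<-* (suc top) (top * top) c ⟩
      top * top * Σ< (suc top) c            ≡⟨ cong (top * top *_) (Balanced.total balanced) ⟩
      top * top * (4 * k)                   ≡⟨ *-comm (top * top) (4 * k) ⟩
      max-energy                            ∎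
      where
      open ≤-Reasoning
      w²c≤top²c : ∀ w → w < suc top → w * w * c w ≤ top * top * c w
      w²c≤top²c w (s≤s w≤top) = *-monoˡ-≤ (c w) (*-mono-≤ w≤top w≤top)

    module _ {c : ℕ → ℕ} (v : ℕ) (v<4k : v < 4 * k) (2≤c : 2 ≤ c (suc v)) where

      private
        v+2<L : suc (suc v) < suc top
        v+2<L = s<s (s<s v<4k)

        u*[a+1] : ∀ a → u * (a + 1) ≡ u * a + u
        u*[a+1] a = trans (*-distribˡ-+ u a 1) (cong (u * a +_) (*-identityʳ u))

      split-balanced : Balanced c → Balanced (split v c)
      split-balanced balanced = record
        { total  = begin
            Σ< (suc top) (split v c)              ≡⟨ Σ<-cong (suc top) (λ w → *-identityˡ (split v c w)) ⟨
            Σ< (suc top) (λ w → 1 * split v c w)  ≡⟨ Σ<-split-moment v c (λ _ → 1) 0 2≤c v+2<L refl ⟩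
            Σ< (suc top) (λ w → 1 * c w) + 0      ≡⟨ +-identityʳ _ ⟩
            Σ< (suc top) (λ w → 1 * c w)          ≡⟨ Σ<-cong (suc top) (λ w → *-identityˡ (c w)) ⟩
            Σ< (suc top) c                        ≡⟨ Balanced.total balanced ⟩
            4 * k                                 ∎
        ; moment = begin
            Σ< (suc top) (λ w → w * split v c w)  ≡⟨ Σ<-split-moment v c (λ w → w) 0 2≤c v+2<L (linear v) ⟩
            Σ< (suc top) (λ w → w * c w) + 0      ≡⟨ +-identityʳ _ ⟩
            Σ< (suc top) (λ w → w * c w)          ≡⟨ Balanced.moment balanced ⟩
            k * (4 * k)                           ∎
        }
        where
        open ≡-Reasoning
        linear : ∀ v → v + suc (suc v) ≡ 2 * suc v + 0
        linear = solve-∀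

      split-energy : energy (split v c) ≡ energy c + 2
      split-energy = Σ<-split-moment v c (λ w → w * w) 2 2≤c v+2<L (convex v)
        where
        convex : ∀ v → v * v + suc (suc v) * suc (suc v) ≡ 2 * (suc v * suc v) + 2
        convex = solve-∀

      split-represents : ∀ {f g} → Represents f c → SplitAt (level k (suc v)) u f g → Represents g (split v c)
      split-represents {f} {g} rep s w with w ≟ suc v | w ≟ v | w ≟ suc (suc v)
      ... | yes refl | _ | _ = +-cancelʳ-≤ (2 * u) _ _ (begin
        u * split v c (suc v) + 2 * u  ≡⟨ cong (u * split v c (suc v) +_) (*-comm 2 u) ⟩
        u * split v c (suc v) + u * 2  ≡⟨ *-distribˡ-+ u (split v c (suc v)) 2 ⟨
        u * (split v c (suc v) + 2)    ≡⟨ cong (u *_) (split-middle v c 2≤c) ⟩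
        u * c (suc v)                  ≤⟨ rep (suc v) ⟩
        countEq f (level k (suc v))    ≤⟨ SplitAt.at s ⟩
        countEq g (level k (suc v)) + 2 * u ∎)
        where open ≤-Reasoning
      ... | no _ | yes refl | _ = begin
        u * split v c v                          ≡⟨ cong (u *_) (split-below v c) ⟩
        u * (c v + 1)                            ≡⟨ u*[a+1] (c v) ⟩
        u * c v + u                              ≤⟨ +-monoˡ-≤ u (rep v) ⟩
        countEq f (level k v) + u                ≡⟨ cong (λ y → countEq f y + u) (level-suc+½ k v) ⟨
        countEq f (level k (suc v) ℚ.+ ½) + u    ≤⟨ SplitAt.above s ⟩
        countEq g (level k (suc v) ℚ.+ ½)        ≡⟨ cong (countEq g) (level-suc+½ k v) ⟩
        countEq g (level k v)                    ∎
        where open ≤-Reasoning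
      ... | no _ | no _ | yes refl = begin
        u * split v c (suc (suc v))              ≡⟨ cong (u *_) (split-above v c) ⟩
        u * (c (suc (suc v)) + 1)                ≡⟨ u*[a+1] (c (suc (suc v))) ⟩
        u * c (suc (suc v)) + u                  ≤⟨ +-monoˡ-≤ u (rep (suc (suc v))) ⟩
        countEq f (level k (suc (suc v))) + u    ≤⟨ SplitAt.below s ⟩
        countEq g (level k (suc (suc v)))        ∎
        where open ≤-Reasoning
      ... | no w≢v+1 | no w≢v | no w≢v+2 = begin
        u * split v c w          ≡⟨ cong (u *_) (split-elsewhere v c w w≢v w≢v+1 w≢v+2) ⟩
        u * c w                  ≤⟨ rep w ⟩
        countEq f (level k w)    ≤⟨ SplitAt.elsewhere s (level k w) (w≢v+1 ∘ level-injective k) ⟩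
        countEq g (level k w)    ∎
        where open ≤-Reasoning

    goal-reached : ∀ {c f} → Represents f c → k ≤ c 0 → Goal f
    goal-reached {c} {f} rep k≤c₀ = begin
      k * u                  ≡⟨ *-comm k u ⟩
      u * k                  ≤⟨ *-monoʳ-≤ u k≤c₀ ⟩
      u * c 0                ≤⟨ rep 0 ⟩
      countEq f (level k 0)  ∎
      where open ≤-Reasoning

    splittable-level : ∀ {c} → Balanced c → ¬ (k ≤ c 0) → ∃ λ v → v < 4 * k × 2 ≤ c (suc v)
    splittable-level {c} balanced k≰c₀ with anyUpTo? (λ v → 2 ≤? c (suc v)) (4 * k)
    ... | yes found = found
    ... | no  none  =
      ⊥-elim (k≰c₀ (sparse⇒k≤c₀ k c c≤1 (Balanced.total balanced) (Balanced.moment balanced)))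
      where
      c≤1 : ∀ v → v < 4 * k → c (suc v) ≤ 1
      c≤1 v v<4k = ≤-pred (≰⇒> (λ 2≤c → none (v , v<4k , 2≤c)))

    force : ∀ t {c f} → Balanced c → Represents f c → max-energy ≤ 2 * t + energy c → CanForce t Goal f
    force t {c} {f} balanced rep budget with k ≤? c 0
    ... | yes k≤c₀ = CanForce-now t (goal-reached rep k≤c₀)
    ... | no  k≰c₀ with splittable-level balanced k≰c₀
    ... | v , v<4k , 2≤c = play t budget
      where
      balanced′ : Balanced (split v c)
      balanced′ = split-balanced v v<4k 2≤c balanced
      play : ∀ t → max-energy ≤ 2 * t + energy c → CanForce t Goal f
      play zero    budget = ⊥-elim (<⇒≱ (m<m+n (energy c) z<s) (begin
        energy c + 2        ≡⟨ split-energy v v<4k 2≤c ⟨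
        energy (split v c)  ≤⟨ energy-bounded balanced′ ⟩
        max-energy          ≤⟨ budget ⟩
        energy c            ∎))
        where open ≤-Reasoning
      play (suc t) budget =
        CanForce-suc t (split-round f (level k (suc v)) u u≥1 2u≤)
          (λ s → force t balanced′ (split-represents v v<4k 2≤c rep s) budget′)
        where
        2u≤ : 2 * u ≤ countEq f (level k (suc v))
        2u≤ = ≤-trans (≤-reflexive (*-comm 2 u)) (≤-trans (*-monoʳ-≤ u 2≤c) (rep (suc v)))
        shift : ∀ t e → 2 * suc t + e ≡ 2 * t + (e + 2)
        shift = solve-∀
        budget′ : max-energy ≤ 2 * t + energy (split v c)
        budget′ = begin
          max-energy                  ≤⟨ budget ⟩
          2 * suc t + energy c        ≡⟨ shift t (energy c) ⟩
          2 * t + (energy c + 2)      ≡⟨ cong (2 * t +_) (split-energy v v<4k 2≤c) ⟨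
          2 * t + energy (split v c)  ∎
          where open ≤-Reasoning

    initial : ℕ → ℕ
    initial = point k (4 * k)

    initial-balanced : Balanced initial
    initial-balanced = record
      { total  = begin
          Σ< (suc top) initial                ≡⟨ Σ<-cong (suc top) (λ w → *-identityˡ (initial w)) ⟨
          Σ< (suc top) (λ w → 1 * initial w)  ≡⟨ Σ<-point (λ _ → 1) (4 * k) k<L ⟩
          1 * (4 * k)                         ≡⟨ *-identityˡ (4 * k) ⟩
          4 * k                               ∎
      ; moment = Σ<-point (λ w → w) (4 * k) k<L
      }
      where
      open ≡-Reasoning
      k<L : k < suc top
      k<L = s≤s (≤-trans (m≤n*m k 4) (n≤1+n _))

    initial-represents : ∀ {f} → 4 * k * u ≤ countEq f 0ℚ → Represents f initial
    initial-represents {f} enough w with w ≟ k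
    ... | yes refl = begin
      u * initial k          ≡⟨ cong (u *_) (point-self k (4 * k)) ⟩
      u * (4 * k)            ≡⟨ *-comm u (4 * k) ⟩
      4 * k * u              ≤⟨ enough ⟩
      countEq f 0ℚ           ≡⟨ cong (countEq f) (level-self k) ⟨
      countEq f (level k k)  ∎
      where open ≤-Reasoning
    ... | no w≢k rewrite point-elsewhere k (4 * k) w w≢k | *-zeroʳ u = z≤n

    wins-within : ∀ t {f} → 4 * k * u ≤ countEq f 0ℚ → max-energy ≤ 2 * t → CanForce t Goal f
    wins-within t enough budget =
      force t initial-balanced (initial-represents enough) (≤-trans budget (m≤m+n (2 * t) _))

open import Data.Nat using (ℕ; zero; suc; _*_; _^_; _≤_; _<_; _/_; s≤s; z≤n)
open import Data.Nat.Properties using (*-comm; *-monoʳ-≤; *-mono-≤; +-monoˡ-≤; module ≤-Reasoning)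
open import Data.Nat.Divisibility using (_∣_; divides)
open import Data.Nat.DivMod using (m*n/n≡m)
open import Data.Nat.Tactic.RingSolver using (solve-∀)
open import Data.Integer using (+_)
open import Data.Rational using (0ℚ) renaming (_/_ to _/ℚ_)
open import Data.Product using (Σ; _,_)
open import Relation.Binary.PropositionalEquality
open Game using (CanForce-mono)

max-energy≤100k³ : ∀ k → 1 ≤ k → 4 * k * (suc (4 * k) * suc (4 * k)) ≤ 2 * (50 * k ^ 3)
max-energy≤100k³ k 1≤k = begin
  4 * k * (suc (4 * k) * suc (4 * k))  ≤⟨ *-monoʳ-≤ (4 * k) (*-mono-≤ 1+4k≤5k 1+4k≤5k) ⟩
  4 * k * (5 * k * (5 * k))            ≡⟨ expand k ⟩
  2 * (50 * k ^ 3)                     ∎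
  where
  open ≤-Reasoning
  1+4k≤5k : suc (4 * k) ≤ 5 * k
  1+4k≤5k = +-monoˡ-≤ (4 * k) 1≤k
  expand : ∀ k → 4 * k * (5 * k * (5 * k)) ≡ 2 * (50 * (k * (k * (k * 1))))
  expand = solve-∀

lemma5p4 : Σ ℕ λ C → (n k m : ℕ) → 0 < k → 0 < m → (4 * k) ∣ m → m ≤ n →
    (f : Fills n) → m ≤ countEq f 0ℚ →
    CanForce (C * k ^ 3) (λ g → m / 4 ≤ countEq g (+ k /ℚ 2)) f
lemma5p4 = 50 , filler-wins
  where
  filler-wins : (n k m : ℕ) → 0 < k → 0 < m → (4 * k) ∣ m → m ≤ n →
    (f : Fills n) → m ≤ countEq f 0ℚ →
    CanForce (50 * k ^ 3) (λ g → m / 4 ≤ countEq g (+ k /ℚ 2)) f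
  filler-wins n k .(0 * (4 * k)) _   () (divides zero refl) _ _ _
  filler-wins n k .(q * (4 * k)) 0<k _  (divides q@(suc _) refl) _ f enough =
    CanForce-mono (50 * k ^ 3) (λ {g} → subst (_≤ countEq g (+ k /ℚ 2)) (sym m/4≡kq))
      (Strategy.wins-within {n} k q (s≤s z≤n) (50 * k ^ 3)
        (subst (_≤ countEq f 0ℚ) (*-comm q (4 * k)) enough) (max-energy≤100k³ k 0<k))
    where
    regroup : ∀ q k → q * (4 * k) ≡ k * q * 4
    regroup = solve-∀
    m/4≡kq : q * (4 * k) / 4 ≡ k * q
    m/4≡kq = trans (cong (_/ 4) (regroup q k)) (m*n/n≡m (k * q) 4)
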